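{- Let $N = q^k n^2$ be an odd perfect number given in Eulerian form. Define $H = \gcd(n^2,\sigma(n^2))$, $I = \gcd(n,\sigma(n^2))$ and $J = H/I$. Then $J = 1$ if and only if $n$ divides $\sigma(q^k)/2$.
   Context: $\sigma(x)$ denotes the sum of the positive divisors of $x$. A positive integer $N$ is perfect if $\sigma(N)=2N$. An odd perfect number $N$ is said to be given in Eulerian form $N = q^k n^2$ if $q$ is a prime (the special prime), $k$ and $n$ are positive integers, $q \equiv k \equiv 1 \pmod 4$, and $\gcd(q,n)=1$. -}

module Defs where

open import Data.Nat using (ℕ; zero; suc; _+_; _*_; _^_; _%_; _≤_)
open import Data.Nat.Divisibility using (_∣_; _∣?_)
open import Data.Nat.DivMod using (_/_)
open import Data.Nat.GCD using (gcd)
open import Data.Nat.Primality using (Prime)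
open import Data.List using (List; filter; upTo; map)
open import Data.Nat.ListAction using (sum)
open import Relation.Binary.PropositionalEquality using (_≡_)
open import Data.Product using (_×_; Σ)

σ : ℕ → ℕ
σ x = sum (filter (λ d → d ∣? x) (map suc (upTo x)))

Perfect : ℕ → Set
Perfect N = σ N ≡ 2 * N

-- natural-number division, with the (irrelevant here) convention m ÷ 0 = 0
_÷_ : ℕ → ℕ → ℕ
m ÷ zero = 0
m ÷ suc d = m / suc d

record EulerianOPN (N q k n : ℕ) : Set where
  field
    perfect   : Perfect N
    odd       : N % 2 ≡ 1
    form      : N ≡ q ^ k * n ^ 2
    q-prime   : Prime q
    k-pos     : 1 ≤ k
    n-pos     : 1 ≤ n
    q≡1mod4   : q % 4 ≡ 1
    k≡1mod4   : k % 4 ≡ 1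
    coprime   : gcd q n ≡ 1

H : ℕ → ℕ
H n = gcd (n ^ 2) (σ (n ^ 2))

I : ℕ → ℕ
I n = gcd n (σ (n ^ 2))

J : ℕ → ℕ
J n = H n ÷ I n

-- Write Q = q^k and A = n².  Since σ is multiplicative and q ∤ A, perfection reads
-- σ(Q) σ(A) = 2 Q A.  As q and k are odd, σ(Q) = 1 + q + ⋯ + q^k has an even number of odd
-- terms, so σ(Q) = 2s; moreover s is coprime to q.  Hence s σ(A) = Q A forces A = m s and
-- σ(A) = Q m for some m, so H = gcd(m s, m Q) = m.  As I ∣ H, J = 1 iff m = I iff m ∣ n,
-- and because n² = m s this happens iff n ∣ s.
module Submission where

open import Data.Empty using (⊥-elim)
open import Data.List using (List; []; _∷_; filter; upTo; map; _++_)
open import Data.List.Membership.Propositional using (_∈_)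
open import Data.List.Membership.Propositional.Properties
  using (∈-filter⁻; ∈-filter⁺; ∈-map⁺; ∈-map⁻; ∈-upTo⁺; ∈-++⁻; ∈-++⁺ˡ; ∈-++⁺ʳ)
open import Data.List.Membership.Propositional.Properties.WithK using (unique∧set⇒bag)
open import Data.List.Relation.Binary.BagAndSetEquality using (_∼[_]_; set; ∼bag⇒↭)
open import Data.List.Relation.Unary.Unique.Propositional using (Unique)
import Data.List.Relation.Unary.Unique.Propositional.Properties as Unique
open import Data.Nat
open import Data.Nat.Coprimality using (Coprime; coprime-divisor; coprime⇒gcd≡1; gcd≡1⇒coprime)
open import Data.Nat.Divisibility
open import Data.Nat.DivMod using (m≡m%n+[m/n]*n; m*n/n≡m; n/n≡1; m∣n⇒o%n%m≡o%m)
open import Data.Nat.GCD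
  using (gcd; gcd-greatest; gcd[m,n]∣m; gcd[m,n]∣n; gcd[m,n]≢0; c*gcd[m,n]≡gcd[cm,cn])
open import Data.Nat.ListAction using (sum)
open import Data.Nat.ListAction.Properties using (sum-↭; sum-++)
open import Data.Nat.Primality using (Prime; prime⇒irreducible; prime⇒nonZero; ¬prime[1])
open import Data.Nat.Properties
open import Data.Nat.Tactic.RingSolver using (solve-∀)
open import Data.Product using (Σ; _×_; _,_; proj₂)
open import Data.Sum using (inj₁; inj₂)
open import Function.Bundles using (_⇔_; mk⇔)
open import Function.Construct.Composition using (_⇔-∘_)
open import Relation.Nullary using (¬_; yes; no)
open import Relation.Binary.PropositionalEquality hiding (J)

open import Defs

divisors : ℕ → List ℕ
divisors x = filter (_∣? x) (map suc (upTo x))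

divisors-unique : ∀ x → Unique (divisors x)
divisors-unique x = Unique.filter⁺ (_∣? x) (Unique.map⁺ suc-injective (Unique.upTo⁺ x))

∈-divisors⁻ : ∀ {d x} → d ∈ divisors x → d ∣ x
∈-divisors⁻ {x = x} d∈ = proj₂ (∈-filter⁻ (_∣? x) {xs = map suc (upTo x)} d∈)

∈-divisors⁺ : ∀ {d x} → .{{NonZero x}} → d ∣ x → d ∈ divisors x
∈-divisors⁺ {zero}  {x} d∣x = ⊥-elim (≢-nonZero⁻¹ x (0∣⇒≡0 d∣x))
∈-divisors⁺ {suc d} {x} d∣x = ∈-filter⁺ (_∣? x) (∈-map⁺ suc (∈-upTo⁺ (∣⇒≤ d∣x))) d∣x

sum-cong-set : ∀ {xs ys} → Unique xs → Unique ys → xs ∼[ set ] ys → sum xs ≡ sum ys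
sum-cong-set uxs uys xs≈ys = sum-↭ (∼bag⇒↭ (unique∧set⇒bag uxs uys xs≈ys))

sum-map-* : ∀ c xs → sum (map (c *_) xs) ≡ c * sum xs
sum-map-* c []       = sym (*-zeroʳ c)
sum-map-* c (x ∷ xs) = trans (cong (c * x +_) (sum-map-* c xs)) (sym (*-distribˡ-+ c x (sum xs)))

prime∤⇒coprime : ∀ {p d} → Prime p → ¬ p ∣ d → Coprime d p
prime∤⇒coprime p-prime p∤d (i∣d , i∣p) with prime⇒irreducible p-prime i∣p
... | inj₁ i≡1 = i≡1
... | inj₂ refl = ⊥-elim (p∤d i∣d)

coprime-∣ˡ : ∀ {a b c} → Coprime a b → c ∣ a → Coprime c b
coprime-∣ˡ a⊥b c∣a (i∣c , i∣b) = a⊥b (∣-trans i∣c c∣a , i∣b)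

coprime-^ʳ : ∀ {a b} → Coprime a b → ∀ j → Coprime a (b ^ j)
coprime-^ʳ a⊥b zero    (_ , i∣1)     = ∣1⇒≡1 i∣1
coprime-^ʳ a⊥b (suc j) (i∣a , i∣b^1+j) =
  coprime-^ʳ a⊥b j (i∣a , coprime-divisor (coprime-∣ˡ a⊥b i∣a) i∣b^1+j)

prime-coprime⇒∤^ : ∀ {p n} → Prime p → Coprime p n → ∀ j → ¬ p ∣ n ^ j
prime-coprime⇒∤^ p-prime p⊥n j p∣n^j =
  ¬prime[1] (subst Prime (coprime-^ʳ p⊥n j (∣-refl , p∣n^j)) p-prime)

-- A divisor of p · (p^j m) is either coprime to p, hence a divisor of m, or p times a
-- divisor of p^j m; this splits the divisor list.
σ[p^[1+j]*m]≡σ[m]+p*σ[p^j*m] : ∀ {p m} → Prime p → ¬ p ∣ m → .{{NonZero m}} → ∀ j →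
                               σ (p ^ suc j * m) ≡ σ m + p * σ (p ^ j * m)
σ[p^[1+j]*m]≡σ[m]+p*σ[p^j*m] {p} {m} p-prime p∤m j = begin
  σ (p ^ suc j * m)                       ≡⟨ cong σ (*-assoc p (p ^ j) m) ⟩
  sum (divisors (p * X))                  ≡⟨ sum-cong-set (divisors-unique (p * X)) split-unique split ⟩
  sum (divisors m ++ map (p *_) D[X])     ≡⟨ sum-++ (divisors m) (map (p *_) D[X]) ⟩
  σ m + sum (map (p *_) D[X])             ≡⟨ cong (σ m +_) (sum-map-* p D[X]) ⟩
  σ m + p * σ X                           ∎
  where
  open ≡-Reasoning
  X : ℕ
  X = p ^ j * m
  D[X] : List ℕ
  D[X] = divisors X
  instance
    p≢0 : NonZero p
    p≢0 = prime⇒nonZero p-prime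
    X≢0 : NonZero X
    X≢0 = m*n≢0 (p ^ j) m {{m^n≢0 p j}}
    pX≢0 : NonZero (p * X)
    pX≢0 = m*n≢0 p X
  split-unique : Unique (divisors m ++ map (p *_) D[X])
  split-unique =
    Unique.++⁺ (divisors-unique m) (Unique.map⁺ (*-cancelˡ-≡ _ _ p) (divisors-unique X)) disjoint
    where
    disjoint : ∀ {z} → ¬ (z ∈ divisors m × z ∈ map (p *_) D[X])
    disjoint (z∈m , z∈pX) with ∈-map⁻ (p *_) z∈pX
    ... | e , _ , refl = p∤m (∣-trans (m∣m*n e) (∈-divisors⁻ z∈m))
  split : divisors (p * X) ∼[ set ] (divisors m ++ map (p *_) D[X])
  split {z} = mk⇔ to from
    where
    to : z ∈ divisors (p * X) → z ∈ divisors m ++ map (p *_) D[X]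
    to z∈ with p ∣? z
    ... | yes (divides e refl) =
      ∈-++⁺ʳ (divisors m) (subst (_∈ map (p *_) D[X]) (*-comm p e)
        (∈-map⁺ (p *_) (∈-divisors⁺ (*-cancelˡ-∣ p (subst (_∣ p * X) (*-comm e p) (∈-divisors⁻ z∈))))))
    ... | no p∤z =
      ∈-++⁺ˡ (∈-divisors⁺ (coprime-divisor (coprime-^ʳ (prime∤⇒coprime p-prime p∤z) (suc j))
        (subst (z ∣_) (sym (*-assoc p (p ^ j) m)) (∈-divisors⁻ z∈))))
    from : z ∈ divisors m ++ map (p *_) D[X] → z ∈ divisors (p * X)
    from z∈ with ∈-++⁻ (divisors m) z∈
    ... | inj₁ z∈m = ∈-divisors⁺ (∣-trans (∈-divisors⁻ z∈m) (∣n⇒∣m*n p (n∣m*n (p ^ j))))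
    ... | inj₂ z∈pX with ∈-map⁻ (p *_) z∈pX
    ...   | e , e∈X , refl = ∈-divisors⁺ (*-monoʳ-∣ p (∈-divisors⁻ e∈X))

geomSum : ℕ → ℕ → ℕ
geomSum q zero    = 1
geomSum q (suc j) = 1 + q * geomSum q j

σ[p^j*m]≡geomSum*σ[m] : ∀ {p m} → Prime p → ¬ p ∣ m → .{{NonZero m}} → ∀ j →
                        σ (p ^ j * m) ≡ geomSum p j * σ m
σ[p^j*m]≡geomSum*σ[m] {m = m} p-prime p∤m zero =
  trans (cong σ (*-identityˡ m)) (sym (*-identityˡ (σ m)))
σ[p^j*m]≡geomSum*σ[m] {p} {m} p-prime p∤m (suc j) = begin
  σ (p ^ suc j * m)               ≡⟨ σ[p^[1+j]*m]≡σ[m]+p*σ[p^j*m] p-prime p∤m j ⟩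
  σ m + p * σ (p ^ j * m)         ≡⟨ cong (λ t → σ m + p * t) (σ[p^j*m]≡geomSum*σ[m] p-prime p∤m j) ⟩
  σ m + p * (geomSum p j * σ m)   ≡⟨ horner p (geomSum p j) (σ m) ⟩
  geomSum p (suc j) * σ m         ∎
  where
  open ≡-Reasoning
  horner : ∀ a g s → s + a * (g * s) ≡ (1 + a * g) * s
  horner = solve-∀

σ[p^j]≡geomSum : ∀ {p} → Prime p → ∀ j → σ (p ^ j) ≡ geomSum p j
σ[p^j]≡geomSum {p} p-prime j = begin
  σ (p ^ j)              ≡⟨ cong σ (sym (*-identityʳ (p ^ j))) ⟩
  σ (p ^ j * 1)          ≡⟨ σ[p^j*m]≡geomSum*σ[m] p-prime p∤1 j ⟩
  geomSum p j * 1        ≡⟨ *-identityʳ (geomSum p j) ⟩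
  geomSum p j            ∎
  where
  open ≡-Reasoning
  p∤1 : ¬ p ∣ 1
  p∤1 p∣1 = ¬prime[1] (subst Prime (∣1⇒≡1 p∣1) p-prime)

σ[p^j*m]≡σ[p^j]*σ[m] : ∀ {p m} → Prime p → ¬ p ∣ m → .{{NonZero m}} → ∀ j →
                      σ (p ^ j * m) ≡ σ (p ^ j) * σ m
σ[p^j*m]≡σ[p^j]*σ[m] {m = m} p-prime p∤m j =
  trans (σ[p^j*m]≡geomSum*σ[m] p-prime p∤m j) (cong (_* σ m) (sym (σ[p^j]≡geomSum p-prime j)))

geomSum≢0 : ∀ q j → NonZero (geomSum q j)
geomSum≢0 q zero    = _
geomSum≢0 q (suc j) = _

geomSum-coprime : ∀ q j → Coprime (geomSum q j) q
geomSum-coprime q zero    (i∣1 , _) = ∣1⇒≡1 i∣1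
geomSum-coprime q (suc j) {i} (i∣1+qg , i∣q) =
  ∣1⇒≡1 (∣m+n∣m⇒∣n (subst (i ∣_) (+-comm 1 (q * geomSum q j)) i∣1+qg)
                   (∣m⇒∣m*n (geomSum q j) i∣q))

2∣geomSum[1+2i] : ∀ {q} → 2 ∣ suc q → ∀ i → 2 ∣ geomSum q (1 + i * 2)
2∣geomSum[1+2i] {q} 2∣1+q zero    = subst (2 ∣_) (cong suc (sym (*-identityʳ q))) 2∣1+q
2∣geomSum[1+2i] {q} 2∣1+q (suc i) =
  subst (2 ∣_) (sym (two-steps q (geomSum q (1 + i * 2))))
    (∣m∣n⇒∣m+n 2∣1+q (∣n⇒∣m*n (q * q) (2∣geomSum[1+2i] 2∣1+q i)))
  where
  two-steps : ∀ a g → 1 + a * (1 + a * g) ≡ suc a + a * a * g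
  two-steps = solve-∀

m%2≡1⇒m≡1+[m/2]*2 : ∀ m → m % 2 ≡ 1 → m ≡ 1 + (m / 2) * 2
m%2≡1⇒m≡1+[m/2]*2 m m-odd = trans (m≡m%n+[m/n]*n m 2) (cong (_+ (m / 2) * 2) m-odd)

odd⇒2∣geomSum : ∀ q k → q % 2 ≡ 1 → k % 2 ≡ 1 → 2 ∣ geomSum q k
odd⇒2∣geomSum q k q-odd k-odd =
  subst (λ k → 2 ∣ geomSum q k) (sym (m%2≡1⇒m≡1+[m/2]*2 k k-odd))
    (2∣geomSum[1+2i] (divides (suc (q / 2)) (cong suc (m%2≡1⇒m≡1+[m/2]*2 q q-odd))) (k / 2))

m%4≡1⇒m%2≡1 : ∀ m → m % 4 ≡ 1 → m % 2 ≡ 1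
m%4≡1⇒m%2≡1 m m%4≡1 = trans (sym (m∣n⇒o%n%m≡o%m 2 4 m (divides 2 refl))) (cong (_% 2) m%4≡1)

÷≡1⇔≡ : ∀ {a c} → c ∣ a → .{{NonZero c}} → (a ÷ c ≡ 1) ⇔ (a ≡ c)
÷≡1⇔≡ {c = suc c} (divides-refl t) = mk⇔ to (λ a≡c → trans (cong (_/ suc c) a≡c) (n/n≡1 (suc c)))
  where
  to : t * suc c / suc c ≡ 1 → t * suc c ≡ suc c
  to t≡1 = trans (cong (_* suc c) (trans (sym (m*n/n≡m t (suc c))) t≡1)) (*-identityˡ (suc c))

coprime-*-≡⇒common-factor : ∀ {s Q A B} → .{{NonZero s}} → Coprime s Q → s * B ≡ Q * A →
                            Σ ℕ λ m → A ≡ m * s × B ≡ Q * m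
coprime-*-≡⇒common-factor {s} {Q} {A} {B} s⊥Q sB≡QA = m , A≡ms , *-cancelʳ-≡ B (Q * m) s (begin
  B * s           ≡⟨ *-comm B s ⟩
  s * B           ≡⟨ sB≡QA ⟩
  Q * A           ≡⟨ cong (Q *_) A≡ms ⟩
  Q * (m * s)     ≡⟨ *-assoc Q m s ⟨
  Q * m * s       ∎)
  where
  open ≡-Reasoning
  s∣A : s ∣ A
  s∣A = coprime-divisor s⊥Q (divides B (trans (sym sB≡QA) (*-comm s B)))
  m : ℕ
  m = quotient s∣A
  A≡ms : A ≡ m * s
  A≡ms = _∣_.equality s∣A

n*n≡m*s⇒[m∣n⇔n∣s] : ∀ {n m s} → .{{NonZero n}} → n * n ≡ m * s → m ∣ n ⇔ n ∣ s
n*n≡m*s⇒[m∣n⇔n∣s] {n} {m} {s} nn≡ms = mk⇔ to from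
  where
  open ≡-Reasoning
  instance
    m≢0 : NonZero m
    m≢0 = m*n≢0⇒m≢0 m {{subst NonZero nn≡ms (m*n≢0 n n)}}
  to : m ∣ n → n ∣ s
  to (divides t n≡tm) = divides t (*-cancelˡ-≡ s (t * n) m (begin
    m * s           ≡⟨ nn≡ms ⟨
    n * n           ≡⟨ cong (_* n) n≡tm ⟩
    t * m * n       ≡⟨ cong (_* n) (*-comm t m) ⟩
    m * t * n       ≡⟨ *-assoc m t n ⟩
    m * (t * n)     ∎))
  from : n ∣ s → m ∣ n
  from (divides t s≡tn) = divides t (*-cancelʳ-≡ n (t * m) n (begin
    n * n           ≡⟨ nn≡ms ⟩
    m * s           ≡⟨ cong (m *_) s≡tn ⟩
    m * (t * n)     ≡⟨ *-assoc m t n ⟨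
    m * t * n       ≡⟨ cong (_* n) (*-comm m t) ⟩
    t * m * n       ∎))

n^2≡n*n : ∀ n → n ^ 2 ≡ n * n
n^2≡n*n n = cong (n *_) (*-identityʳ n)

gcd[n²,B]÷gcd[n,B]≡1⇔n∣s : ∀ {n m s Q B} → .{{NonZero n}} →
                            n ^ 2 ≡ m * s → B ≡ Q * m → Coprime s Q →
                            (gcd (n ^ 2) B ÷ gcd n B ≡ 1) ⇔ n ∣ s
gcd[n²,B]÷gcd[n,B]≡1⇔n∣s {n} {m} {s} {Q} {B} n²≡ms B≡Qm s⊥Q =
  n*n≡m*s⇒[m∣n⇔n∣s] (trans (sym (n^2≡n*n n)) n²≡ms)
    ⇔-∘ (gcd[n²,B]≡gcd[n,B]⇔m∣n ⇔-∘ ÷≡1⇔≡ gcd[n,B]∣gcd[n²,B])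
  where
  instance
    gcd[n,B]≢0 : NonZero (gcd n B)
    gcd[n,B]≢0 = ≢-nonZero (gcd[m,n]≢0 n B (inj₁ (≢-nonZero⁻¹ n)))
  gcd[n,B]∣gcd[n²,B] : gcd n B ∣ gcd (n ^ 2) B
  gcd[n,B]∣gcd[n²,B] = gcd-greatest (∣-trans (gcd[m,n]∣m n B) (m∣m*n (n * 1))) (gcd[m,n]∣n n B)
  gcd[n²,B]≡m : gcd (n ^ 2) B ≡ m
  gcd[n²,B]≡m = begin
    gcd (n ^ 2) B        ≡⟨ cong₂ gcd n²≡ms (trans B≡Qm (*-comm Q m)) ⟩
    gcd (m * s) (m * Q)  ≡⟨ c*gcd[m,n]≡gcd[cm,cn] m s Q ⟨
    m * gcd s Q          ≡⟨ cong (m *_) (coprime⇒gcd≡1 s⊥Q) ⟩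
    m * 1                ≡⟨ *-identityʳ m ⟩
    m                    ∎
    where open ≡-Reasoning
  m∣B : m ∣ B
  m∣B = subst (m ∣_) (sym B≡Qm) (n∣m*n Q)
  gcd[n²,B]≡gcd[n,B]⇔m∣n : (gcd (n ^ 2) B ≡ gcd n B) ⇔ m ∣ n
  gcd[n²,B]≡gcd[n,B]⇔m∣n = mk⇔
    (λ H≡I → subst (_∣ n) (trans (sym H≡I) gcd[n²,B]≡m) (gcd[m,n]∣m n B))
    (λ m∣n → ∣-antisym
      (subst (_∣ gcd n B) (sym gcd[n²,B]≡m) (gcd-greatest m∣n m∣B))
      gcd[n,B]∣gcd[n²,B])

perfect-q^k*A⇒s*σ[A]≡q^k*A : ∀ {q k A s} → Prime q → ¬ q ∣ A → .{{NonZero A}} →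
                              σ (q ^ k) ≡ s * 2 → Perfect (q ^ k * A) → s * σ A ≡ q ^ k * A
perfect-q^k*A⇒s*σ[A]≡q^k*A {q} {k} {A} {s} q-prime q∤A σ[q^k]≡s*2 perfect =
  *-cancelʳ-≡ (s * σ A) (q ^ k * A) 2 (begin
    s * σ A * 2            ≡⟨ *-assoc s (σ A) 2 ⟩
    s * (σ A * 2)          ≡⟨ cong (s *_) (*-comm (σ A) 2) ⟩
    s * (2 * σ A)          ≡⟨ *-assoc s 2 (σ A) ⟨
    s * 2 * σ A            ≡⟨ cong (_* σ A) σ[q^k]≡s*2 ⟨
    σ (q ^ k) * σ A        ≡⟨ σ[p^j*m]≡σ[p^j]*σ[m] q-prime q∤A k ⟨
    σ (q ^ k * A)          ≡⟨ perfect ⟩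
    2 * (q ^ k * A)        ≡⟨ *-comm 2 (q ^ k * A) ⟩
    q ^ k * A * 2          ∎)
  where open ≡-Reasoning

lemma5 : (N q k n : ℕ) → EulerianOPN N q k n →
    (J n ≡ 1) ⇔ (n ∣ (σ (q ^ k) ÷ 2))
lemma5 N q k n E =
  let m , n²≡ms , σ[n²]≡q^k*m = coprime-*-≡⇒common-factor s⊥q^k s*σ[n²]≡q^k*n²
  in subst (λ t → (J n ≡ 1) ⇔ (n ∣ t)) (sym σ[q^k]÷2≡s)
       (gcd[n²,B]÷gcd[n,B]≡1⇔n∣s n²≡ms σ[n²]≡q^k*m s⊥q^k)
  where
  open EulerianOPN E
  instance
    n≢0 : NonZero n
    n≢0 = >-nonZero n-pos
    n²≢0 : NonZero (n ^ 2)
    n²≢0 = m^n≢0 n 2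
  2∣geomSum[q,k] : 2 ∣ geomSum q k
  2∣geomSum[q,k] = odd⇒2∣geomSum q k (m%4≡1⇒m%2≡1 q q≡1mod4) (m%4≡1⇒m%2≡1 k k≡1mod4)
  s : ℕ
  s = quotient 2∣geomSum[q,k]
  σ[q^k]≡s*2 : σ (q ^ k) ≡ s * 2
  σ[q^k]≡s*2 = trans (σ[p^j]≡geomSum q-prime k) (_∣_.equality 2∣geomSum[q,k])
  σ[q^k]÷2≡s : σ (q ^ k) ÷ 2 ≡ s
  σ[q^k]÷2≡s = trans (cong (_/ 2) σ[q^k]≡s*2) (m*n/n≡m s 2)
  instance
    s≢0 : NonZero s
    s≢0 = quotient≢0 2∣geomSum[q,k] {{geomSum≢0 q k}}
  s⊥q^k : Coprime s (q ^ k)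
  s⊥q^k = coprime-∣ˡ (coprime-^ʳ (geomSum-coprime q k) k) (quotient-∣ 2∣geomSum[q,k])
  s*σ[n²]≡q^k*n² : s * σ (n ^ 2) ≡ q ^ k * n ^ 2
  s*σ[n²]≡q^k*n² = perfect-q^k*A⇒s*σ[A]≡q^k*A {k = k} {s = s} q-prime
    (prime-coprime⇒∤^ q-prime (gcd≡1⇒coprime coprime) 2) σ[q^k]≡s*2 (subst Perfect form perfect)
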